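{- Let $C$ be a code in $K(n,k)$ and let $U_0=\Omega\setminus\bigcup_{\alpha\in C}\alpha$ and $U_1=\bigcap_{\alpha\in C}\alpha$. Then $\mathrm{Aut}(C)$ fixes $U_0$ and $U_1$ setwise and induces $\mathrm{Sym}(U_0)$ on $U_0$ and $\mathrm{Sym}(U_1)$ on $U_1$. In particular, $U_0$ and $U_1$ are $\mathrm{Aut}(C)$-orbits.
   Context: Let $\Omega$ be a finite set with $|\Omega|=n$ and $2\leq k\leq (n-1)/2$. The Kneser graph $K(n,k)$ has as vertices the $k$-subsets of $\Omega$, adjacent iff disjoint; its automorphism group is $\mathrm{Sym}(\Omega)$. A code $C$ is a set of vertices with $|C|\geq 2$, and $\mathrm{Aut}(C)$ is the setwise stabiliser of $C$ in $\mathrm{Sym}(\Omega)$. -}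

module Defs where

open import Data.Nat using (ℕ; _≤_; _+_; _*_)
open import Data.Fin using (Fin)
open import Data.Fin.Subset using (Subset; ∣_∣; ⋃; ⋂; ∁; _∈_)
open import Data.Fin.Permutation using (Permutation′; _⟨$⟩ʳ_; _⟨$⟩ˡ_)
open import Data.Vec using (tabulate; lookup)
open import Data.List using (List; length)
open import Data.List.Relation.Unary.All using (All)
open import Data.List.Relation.Unary.Unique.Propositional using (Unique)
open import Data.List.Membership.Propositional renaming (_∈_ to _∈ₗ_)
open import Data.Product using (_×_; Σ; _,_; proj₁)
open import Function.Bundles using (_⇔_; _↔_; Inverse)
open import Relation.Binary.PropositionalEquality using (_≡_)

-- Ω = Fin n.  Standing Kneser-graph assumption: 2 ≤ k ≤ (n-1)/2, i.e. 2k+1 ≤ n.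
KneserParams : ℕ → ℕ → Set
KneserParams n k = (2 ≤ k) × (2 * k + 1 ≤ n)

record Code (n k : ℕ) : Set where
  field
    elems   : List (Subset n)
    unique  : Unique elems
    kSubset : All (λ α → ∣ α ∣ ≡ k) elems
    size≥2  : 2 ≤ length elems
open Code public

-- Image σ(α) = { σ x | x ∈ α } of a subset under a permutation.
image : ∀ {n} → Permutation′ n → Subset n → Subset n
image σ α = tabulate (λ y → lookup α (σ ⟨$⟩ˡ y))

InAut : ∀ {n k} → Code n k → Permutation′ n → Set
InAut C σ = ∀ α → (α ∈ₗ elems C) ⇔ (image σ α ∈ₗ elems C)

U₀ : ∀ {n k} → Code n k → Subset n
U₀ C = ∁ (⋃ (elems C))

U₁ : ∀ {n k} → Code n k → Subset n
U₁ C = ⋂ (elems C)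

-- Aut(C) induces Sym(U) on U (U assumed Aut(C)-invariant): every permutation τ of
-- the set U is the restriction to U of some element of Aut(C).
InducesSym : ∀ {n k} → Code n k → Subset n → Set
InducesSym {n} C U =
  (τ : Σ (Fin n) (λ x → x ∈ U) ↔ Σ (Fin n) (λ x → x ∈ U)) →
  Σ (Permutation′ n) λ σ →
    InAut C σ × (∀ x (h : x ∈ U) → σ ⟨$⟩ʳ x ≡ proj₁ (Inverse.to τ (x , h)))

-- Aut(C) acts transitively on U (U is a single Aut(C)-orbit, when nonempty).
TransitiveOn : ∀ {n k} → Code n k → Subset n → Set
TransitiveOn {n} C U =
  ∀ x y → x ∈ U → y ∈ U → Σ (Permutation′ n) λ σ → InAut C σ × (σ ⟨$⟩ʳ x ≡ y)

-- Aut(C) permutes the members of C, so it preserves their union and their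
-- intersection, hence U₀ and U₁.  Conversely, no member of C separates two
-- points of U₀ (none meets it) or of U₁ (all contain it).  A permutation of Ω
-- that moves points only inside such an unseparated set fixes every member of C
-- and so lies in Aut(C); every permutation of U, extended by the identity, and
-- every transposition of two points of U are of this kind.
module Submission where

open import Defs
open import Data.Nat using (ℕ)
open import Data.Product using (_×_; Σ; _,_; proj₁; proj₂)
open import Data.Sum using (_⊎_; inj₁; inj₂; [_,_])
open import Data.Fin using (Fin; _≟_)
open import Data.Fin.Subset using (Subset; _∈_; _∉_; ⋃; ⋂; ∁)
open import Data.Fin.Subset.Properties
  using (_∈?_; ⊆-antisym; x∈p∪q⁺; x∈p∪q⁻; x∈p∩q⁺; x∈p∩q⁻; ∉⊥; ∈⊤; x∈∁p⇒x∉p; x∉p⇒x∈∁p)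
open import Data.Fin.Permutation
  using (Permutation′; permutation; transpose; flip; _⟨$⟩ʳ_; _⟨$⟩ˡ_; inverseˡ; inverseʳ)
import Data.Fin.Permutation.Components as PC
open import Data.Vec using (here; there)
open import Data.Vec.Properties using (lookup∘tabulate; []=⇒lookup; lookup⇒[]=)
open import Data.List using (List; []; _∷_)
open import Data.List.Relation.Unary.Any using (Any; here; there)
open import Data.List.Relation.Unary.All as All using (All; []; _∷_)
open import Data.List.Membership.Propositional using (find; lose) renaming (_∈_ to _∈ₗ_)
open import Function using (_∘_)
open import Function.Bundles using (Inverse; Equivalence; mk⇔; _↔_)
open import Relation.Binary.PropositionalEquality using (_≡_; refl; sym; trans; cong; subst)
open import Relation.Nullary using (yes; no; contradiction)
open import Relation.Nullary.Decidable using (dec-true)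

private
  variable
    n k : ℕ
    x y : Fin n
    p U α : Subset n
    ps : List (Subset n)

∈-irrelevant : (h h′ : x ∈ p) → h ≡ h′
∈-irrelevant here      here       = refl
∈-irrelevant (there h) (there h′) = cong there (∈-irrelevant h h′)

x∈⋃⁺ : Any (x ∈_) ps → x ∈ ⋃ ps
x∈⋃⁺ (here x∈p)  = x∈p∪q⁺ (inj₁ x∈p)
x∈⋃⁺ (there x∈⋃) = x∈p∪q⁺ (inj₂ (x∈⋃⁺ x∈⋃))

x∈⋃⁻ : ∀ ps → x ∈ ⋃ ps → Any (x ∈_) ps
x∈⋃⁻ []       x∈⋃ = contradiction x∈⋃ ∉⊥
x∈⋃⁻ (p ∷ ps) x∈⋃ = [ here , there ∘ x∈⋃⁻ ps ] (x∈p∪q⁻ p (⋃ ps) x∈⋃)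

x∈⋂⁺ : All (x ∈_) ps → x ∈ ⋂ ps
x∈⋂⁺ []          = ∈⊤
x∈⋂⁺ (x∈p ∷ x∈⋂) = x∈p∩q⁺ (x∈p , x∈⋂⁺ x∈⋂)

x∈⋂⁻ : ∀ ps → x ∈ ⋂ ps → All (x ∈_) ps
x∈⋂⁻ []       _   = []
x∈⋂⁻ (p ∷ ps) x∈⋂ with x∈p∩q⁻ p (⋂ ps) x∈⋂
... | x∈p , x∈⋂ps = x∈p ∷ x∈⋂⁻ ps x∈⋂ps

y∈image⁺ : (σ : Permutation′ n) → σ ⟨$⟩ˡ y ∈ α → y ∈ image σ α
y∈image⁺ {y = y} σ h = lookup⇒[]= y _ (trans (lookup∘tabulate _ y) ([]=⇒lookup h))

y∈image⁻ : (σ : Permutation′ n) → y ∈ image σ α → σ ⟨$⟩ˡ y ∈ α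
y∈image⁻ {y = y} σ h = lookup⇒[]= _ _ (trans (sym (lookup∘tabulate _ y)) ([]=⇒lookup h))

σx∈image : (σ : Permutation′ n) → x ∈ α → σ ⟨$⟩ʳ x ∈ image σ α
σx∈image {α = α} σ x∈α = y∈image⁺ σ (subst (_∈ α) (sym (inverseˡ σ)) x∈α)

image-flip : (σ : Permutation′ n) (α : Subset n) → image (flip σ) (image σ α) ≡ α
image-flip σ α = ⊆-antisym
  (λ h → subst (_∈ α) (inverseˡ σ) (y∈image⁻ σ (y∈image⁻ (flip σ) h)))
  (λ h → y∈image⁺ (flip σ) (y∈image⁺ σ (subst (_∈ α) (sym (inverseˡ σ)) h)))

Invariant : Permutation′ n → Subset n → Set
Invariant σ p = ∀ {x} → x ∈ p → σ ⟨$⟩ʳ x ∈ p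

image-invariant : (σ : Permutation′ n) → Invariant σ p → Invariant (flip σ) p → image σ p ≡ p
image-invariant {p = p} σ σp σ⁻¹p = ⊆-antisym
  (λ y∈σp → subst (_∈ p) (inverseʳ σ) (σp (y∈image⁻ σ y∈σp)))
  (λ y∈p → y∈image⁺ σ (σ⁻¹p y∈p))

∁-invariant : (σ : Permutation′ n) → Invariant (flip σ) p → Invariant σ (∁ p)
∁-invariant {p = p} σ σ⁻¹p x∈∁p =
  x∉p⇒x∈∁p λ σx∈p → x∈∁p⇒x∉p x∈∁p (subst (_∈ p) (inverseˡ σ) (σ⁻¹p σx∈p))

MapsInto : Permutation′ n → List (Subset n) → Set
MapsInto σ ps = ∀ {α} → α ∈ₗ ps → image σ α ∈ₗ ps

⋃-invariant : (σ : Permutation′ n) → MapsInto σ ps → Invariant σ (⋃ ps)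
⋃-invariant {ps = ps} σ σps x∈⋃ with find (x∈⋃⁻ ps x∈⋃)
... | α , α∈ps , x∈α = x∈⋃⁺ (lose (σps α∈ps) (σx∈image σ x∈α))

⋂-invariant : (σ : Permutation′ n) → MapsInto (flip σ) ps → Invariant σ (⋂ ps)
⋂-invariant {ps = ps} σ σ⁻¹ps x∈⋂ = x∈⋂⁺ (All.tabulate λ β∈ps →
  y∈image⁻ (flip σ) (All.lookup (x∈⋂⁻ ps x∈⋂) (σ⁻¹ps β∈ps)))

module _ (C : Code n k) (σ : Permutation′ n) where

  inAut⇒mapsInto : InAut C σ → MapsInto σ (elems C)
  inAut⇒mapsInto σ∈Aut {α} = Equivalence.to (σ∈Aut α)

  inAut⇒mapsInto-flip : InAut C σ → MapsInto (flip σ) (elems C)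
  inAut⇒mapsInto-flip σ∈Aut {β} β∈C = Equivalence.from (σ∈Aut (image (flip σ) β))
    (subst (_∈ₗ elems C) (sym (image-flip (flip σ) β)) β∈C)

  mapsInto⇒inAut : MapsInto σ (elems C) → MapsInto (flip σ) (elems C) → InAut C σ
  mapsInto⇒inAut σC σ⁻¹C α =
    mk⇔ σC λ σα∈C → subst (_∈ₗ elems C) (image-flip σ α) (σ⁻¹C σα∈C)

Unseparated : List (Subset n) → Subset n → Set
Unseparated ps U = ∀ {α x y} → α ∈ₗ ps → x ∈ U → y ∈ U → x ∈ α → y ∈ α

MovesWithin : Subset n → (Fin n → Fin n) → Set
MovesWithin U f = ∀ x → f x ≡ x ⊎ (x ∈ U × f x ∈ U)

movesWithin⇒invariant : (σ : Permutation′ n) → Unseparated ps U →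
                        MovesWithin U (σ ⟨$⟩ʳ_) → α ∈ₗ ps → Invariant σ α
movesWithin⇒invariant {α = α} σ sep σU α∈ps {x} x∈α with σU x
... | inj₁ σx≡x          = subst (_∈ α) (sym σx≡x) x∈α
... | inj₂ (x∈U , σx∈U) = sep α∈ps x∈U σx∈U x∈α

movesWithin⇒mapsInto : (σ : Permutation′ n) → Unseparated ps U →
                       MovesWithin U (σ ⟨$⟩ʳ_) → MovesWithin U (σ ⟨$⟩ˡ_) → MapsInto σ ps
movesWithin⇒mapsInto {ps = ps} σ sep σU σ⁻¹U α∈ps = subst (_∈ₗ ps)
  (sym (image-invariant σ (movesWithin⇒invariant σ sep σU α∈ps)
                          (movesWithin⇒invariant (flip σ) sep σ⁻¹U α∈ps)))
  α∈ps

movesWithin⇒inAut : (C : Code n k) (σ : Permutation′ n) → Unseparated (elems C) U →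
                    MovesWithin U (σ ⟨$⟩ʳ_) → MovesWithin U (σ ⟨$⟩ˡ_) → InAut C σ
movesWithin⇒inAut C σ sep σU σ⁻¹U = mapsInto⇒inAut C σ
  (movesWithin⇒mapsInto σ sep σU σ⁻¹U) (movesWithin⇒mapsInto (flip σ) sep σ⁻¹U σU)

module _ (U : Subset n) where

  private
    Ũ : Set
    Ũ = Σ (Fin n) (_∈ U)

  extend : (Ũ → Ũ) → Fin n → Fin n
  extend f x with x ∈? U
  ... | yes x∈U = proj₁ (f (x , x∈U))
  ... | no  _   = x

  extend-∈ : (f : Ũ → Ũ) (x∈U : x ∈ U) → extend f x ≡ proj₁ (f (x , x∈U))
  extend-∈ {x = x} f x∈U with x ∈? U
  ... | yes x∈U′ = cong (λ h → proj₁ (f (x , h))) (∈-irrelevant x∈U′ x∈U)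
  ... | no  x∉U  = contradiction x∈U x∉U

  extend-∉ : (f : Ũ → Ũ) → x ∉ U → extend f x ≡ x
  extend-∉ {x = x} f x∉U with x ∈? U
  ... | yes x∈U = contradiction x∈U x∉U
  ... | no  _   = refl

  extend-movesWithin : (f : Ũ → Ũ) → MovesWithin U (extend f)
  extend-movesWithin f x with x ∈? U
  ... | yes x∈U = inj₂ (x∈U , proj₂ (f (x , x∈U)))
  ... | no  _   = inj₁ refl

  extend-inverse : (f g : Ũ → Ũ) → (∀ s → g (f s) ≡ s) → ∀ x → extend g (extend f x) ≡ x
  extend-inverse f g g∘f x with x ∈? U
  ... | yes x∈U = trans (extend-∈ g (proj₂ (f (x , x∈U)))) (cong proj₁ (g∘f (x , x∈U)))
  ... | no  x∉U = extend-∉ g x∉U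

  extendPermutation : Ũ ↔ Ũ → Permutation′ n
  extendPermutation τ = permutation (extend to) (extend from)
      (extend-inverse from to strictlyInverseˡ) (extend-inverse to from strictlyInverseʳ)
    where open Inverse τ

transpose-movesWithin : x ∈ U → y ∈ U → MovesWithin U (PC.transpose x y)
transpose-movesWithin {x = x} {y = y} x∈U y∈U z with z ≟ x
... | yes refl = inj₂ (x∈U , y∈U)
... | no  _    with z ≟ y
...   | yes refl = inj₂ (y∈U , x∈U)
...   | no  _    = inj₁ refl

transpose-sends : (x y : Fin n) → PC.transpose x y x ≡ y
transpose-sends x y rewrite dec-true (x ≟ x) refl = refl

module _ (C : Code n k) (sep : Unseparated (elems C) U) where

  unseparated⇒inducesSym : InducesSym C U
  unseparated⇒inducesSym τ =
    σ , movesWithin⇒inAut C σ sep (extend-movesWithin U _) (extend-movesWithin U _) ,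
    λ _ x∈U → extend-∈ U (Inverse.to τ) x∈U
    where σ = extendPermutation U τ

  unseparated⇒transitiveOn : TransitiveOn C U
  unseparated⇒transitiveOn x y x∈U y∈U =
    transpose x y ,
    movesWithin⇒inAut C (transpose x y) sep
      (transpose-movesWithin x∈U y∈U) (transpose-movesWithin y∈U x∈U) ,
    transpose-sends x y

U₀-unseparated : (C : Code n k) → Unseparated (elems C) (U₀ C)
U₀-unseparated C α∈C x∈U₀ _ x∈α = contradiction (x∈⋃⁺ (lose α∈C x∈α)) (x∈∁p⇒x∉p x∈U₀)

U₁-unseparated : (C : Code n k) → Unseparated (elems C) (U₁ C)
U₁-unseparated C α∈C _ y∈U₁ _ = All.lookup (x∈⋂⁻ (elems C) y∈U₁) α∈C

image-U₀ : (C : Code n k) (σ : Permutation′ n) → InAut C σ → image σ (U₀ C) ≡ U₀ C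
image-U₀ C σ σ∈Aut = image-invariant σ
  (∁-invariant σ (⋃-invariant (flip σ) (inAut⇒mapsInto-flip C σ σ∈Aut)))
  (∁-invariant (flip σ) (⋃-invariant σ (inAut⇒mapsInto C σ σ∈Aut)))

image-U₁ : (C : Code n k) (σ : Permutation′ n) → InAut C σ → image σ (U₁ C) ≡ U₁ C
image-U₁ C σ σ∈Aut = image-invariant σ
  (⋂-invariant σ (inAut⇒mapsInto-flip C σ σ∈Aut))
  (⋂-invariant (flip σ) (inAut⇒mapsInto C σ σ∈Aut))

lemma4p4 : (n k : ℕ) → KneserParams n k → (C : Code n k) →
    ((σ : Permutation′ n) → InAut C σ →
       (image σ (U₀ C) ≡ U₀ C) × (image σ (U₁ C) ≡ U₁ C))
    × InducesSym C (U₀ C) × InducesSym C (U₁ C)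
    × TransitiveOn C (U₀ C) × TransitiveOn C (U₁ C)
lemma4p4 n k _ C =
  (λ σ σ∈Aut → image-U₀ C σ σ∈Aut , image-U₁ C σ σ∈Aut) ,
  unseparated⇒inducesSym C (U₀-unseparated C) ,
  unseparated⇒inducesSym C (U₁-unseparated C) ,
  unseparated⇒transitiveOn C (U₀-unseparated C) ,
  unseparated⇒transitiveOn C (U₁-unseparated C)
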